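{- For integers $r\ge 1$, $s\ge 2$ and each $m\in\{1,2,3\}$, $\chi_{la}(H_m(r,s))=3$.
   Context: For a graph $G=(V,E)$ with $|E|=m$ and no isolated vertices, a local antimagic labeling is a bijection $f:E\to\{1,\dots,m\}$ such that $f^+(u)\ne f^+(v)$ for every edge $uv$, where $f^+(x)=\sum f(e)$ over all edges $e$ incident to $x$. The local antimagic chromatic number $\chi_{la}(G)$ is the minimum, over all local antimagic labelings $f$ of $G$, of the number of distinct values taken by $f^+$ (also for disconnected graphs). Merging a set of vertices means identifying them into one vertex incident to all edges previously incident to any of them. Let $n=rs$. Take $n$ disjoint copies of $C_4(8,2)$ indexed $i=1,\dots,n$, the $i$-th copy having vertices $\{u_{i,t},v_{i,t}:1\le t\le 8\}$ and edges $u_{i,t}u_{i,t+1}$, $v_{i,t}v_{i,t+1}$ ($1\le t\le 8$, second index mod 8) and $u_{i,2j}v_{i,2j}$ ($1\le j\le 4$). For each $i$, define merged vertices as follows. In $H_1(n)$: $x_{i,1}=\{u_{i,1},u_{i,5}\}$, $x_{i,2}=\{u_{i,3},u_{i,7}\}$, $y_{i,1}=\{v_{i,1},v_{i,5}\}$, $y_{i,2}=\{v_{i,3},v_{i,7}\}$. In $H_2(n)$: $x_{i,1}=\{u_{i,1},v_{i,7}\}$, $x_{i,2}=\{u_{i,5},v_{i,3}\}$, $y_{i,1}=\{u_{i,3},v_{i,5}\}$, $y_{i,2}=\{u_{i,7},v_{i,1}\}$. In $H_3(n)$: $x_{i,1}=\{u_{i,1},v_{i,1}\}$, $x_{i,2}=\{u_{i,5},v_{i,5}\}$,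 $y_{i,1}=\{u_{i,3},v_{i,3}\}$, $y_{i,2}=\{u_{i,7},v_{i,7}\}$ (each listed pair is merged into the single named vertex). For $m=1,2,3$, $H_m(r,s)$ is obtained from $H_m(n)$ by merging, for each $b\in[1,r]$ and $j\in\{1,2\}$, the set $\{x_{(b-1)s+i,j}:1\le i\le s\}$ into one vertex and the set $\{y_{(b-1)s+i,j}:1\le i\le s\}$ into one vertex. -}

module Defs where

open import Data.Nat using (ℕ; zero; suc; _≤_; _+_; _*_; _∸_)
import Data.Nat as ℕ
open import Data.Fin using (Fin)
open import Data.Nat.ListAction using (sum)
open import Data.List using (List; []; _∷_; length; lookup; map; allFin; upTo; concatMap; deduplicate; filter)
open import Data.Product using (_×_; _,_; proj₁; proj₂; ∃; Σ)
open import Data.Sum using (_⊎_)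
open import Relation.Binary.PropositionalEquality using (_≡_; _≢_; refl; cong)
open import Relation.Binary.Definitions using (DecidableEquality)
open import Relation.Nullary using (Dec; yes; no; does)
open import Relation.Nullary.Decidable using (_⊎-dec_)
open import Function.Definitions using (Injective)

-- The vertex set is the set of endpoints of
-- edges (so there are no isolated vertices).

record Graph : Set₁ where
  field
    V     : Set
    _≟V_  : DecidableEquality V
    edges : List (V × V)

module _ (G : Graph) where
  open Graph G

  #E : ℕ
  #E = length edges

  edge : Fin #E → V × V
  edge e = lookup edges e

  record Labeling : Set where
    field
      lab        : Fin #E → ℕ
      lab-inj    : Injective _≡_ _≡_ lab
      lab-range  : ∀ e → 1 ≤ lab e × lab e ≤ #E
      lab-onto   : ∀ k → 1 ≤ k → k ≤ #E → ∃ λ e → lab e ≡ k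
  open Labeling public

  incident? : (x : V) → (e : Fin #E) → Dec (x ≡ proj₁ (edge e) ⊎ x ≡ proj₂ (edge e))
  incident? x e = (x ≟V proj₁ (edge e)) ⊎-dec (x ≟V proj₂ (edge e))

  vsum : Labeling → V → ℕ
  vsum f x = sum (map (lab f) (filter (incident? x) (allFin #E)))

  IsLocalAntimagic : Labeling → Set
  IsLocalAntimagic f = ∀ e → vsum f (proj₁ (edge e)) ≢ vsum f (proj₂ (edge e))

  vertexList : List V
  vertexList = concatMap (λ p → proj₁ p ∷ proj₂ p ∷ []) edges

  numColours : Labeling → ℕ
  numColours f = length (deduplicate ℕ._≟_ (map (vsum f) vertexList))

  ChiLa≡ : ℕ → Set
  ChiLa≡ k = (Σ Labeling λ f → IsLocalAntimagic f × numColours f ≡ k)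
           × (∀ f → IsLocalAntimagic f → k ≤ numColours f)

-- Copies of C₄(8,2) are indexed by pairs (b , i), 1 ≤ b ≤ r, 1 ≤ i ≤ s,
-- corresponding to the paper's copy index (b-1)s + i.
-- Original vertex: orig b i side t  with t ∈ {1,…,8}.

data Side : Set where
  u v : Side

_≟S_ : DecidableEquality Side
u ≟S u = yes refl
u ≟S v = no λ ()
v ≟S u = no λ ()
v ≟S v = yes refl

-- Vertices of H_m(r,s): unmerged original vertices, or the merged
-- vertices X b j (= merge of x_{(b-1)s+i,j}, 1 ≤ i ≤ s) and Y b j.
data MV : Set where
  orig : (b i : ℕ) → Side → (t : ℕ) → MV
  X    : (b j : ℕ) → MV
  Y    : (b j : ℕ) → MV

private
  cong4 : ∀ {b b' i i' s s' t t'} → b ≡ b' → i ≡ i' → s ≡ s' → t ≡ t' →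
          orig b i s t ≡ orig b' i' s' t'
  cong4 refl refl refl refl = refl

_≟MV_ : DecidableEquality MV
orig b i s t ≟MV orig b' i' s' t' with b ℕ.≟ b' | i ℕ.≟ i' | s ≟S s' | t ℕ.≟ t'
... | yes p | yes q | yes r | yes w = yes (cong4 p q r w)
... | no ¬p | _ | _ | _ = no λ { refl → ¬p refl }
... | yes _ | no ¬q | _ | _ = no λ { refl → ¬q refl }
... | yes _ | yes _ | no ¬r | _ = no λ { refl → ¬r refl }
... | yes _ | yes _ | yes _ | no ¬w = no λ { refl → ¬w refl }
orig _ _ _ _ ≟MV X _ _ = no λ ()
orig _ _ _ _ ≟MV Y _ _ = no λ ()
X _ _ ≟MV orig _ _ _ _ = no λ ()
X b j ≟MV X b' j' with b ℕ.≟ b' | j ℕ.≟ j'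
... | yes refl | yes refl = yes refl
... | no ¬p | _ = no λ { refl → ¬p refl }
... | yes _ | no ¬q = no λ { refl → ¬q refl }
X _ _ ≟MV Y _ _ = no λ ()
Y _ _ ≟MV orig _ _ _ _ = no λ ()
Y _ _ ≟MV X _ _ = no λ ()
Y b j ≟MV Y b' j' with b ℕ.≟ b' | j ℕ.≟ j'
... | yes refl | yes refl = yes refl
... | no ¬p | _ = no λ { refl → ¬p refl }
... | yes _ | no ¬q = no λ { refl → ¬q refl }

merge₁ : ℕ → ℕ → Side → ℕ → MV
merge₁ b i u 1 = X b 1
merge₁ b i u 5 = X b 1
merge₁ b i u 3 = X b 2
merge₁ b i u 7 = X b 2
merge₁ b i v 1 = Y b 1
merge₁ b i v 5 = Y b 1
merge₁ b i v 3 = Y b 2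
merge₁ b i v 7 = Y b 2
merge₁ b i s t = orig b i s t

merge₂ : ℕ → ℕ → Side → ℕ → MV
merge₂ b i u 1 = X b 1
merge₂ b i v 7 = X b 1
merge₂ b i u 5 = X b 2
merge₂ b i v 3 = X b 2
merge₂ b i u 3 = Y b 1
merge₂ b i v 5 = Y b 1
merge₂ b i u 7 = Y b 2
merge₂ b i v 1 = Y b 2
merge₂ b i s t = orig b i s t

merge₃ : ℕ → ℕ → Side → ℕ → MV
merge₃ b i s 1 = X b 1
merge₃ b i s 5 = X b 2
merge₃ b i s 3 = Y b 1
merge₃ b i s 7 = Y b 2
merge₃ b i s t = orig b i s t

range1 : ℕ → List ℕ
range1 n = map suc (upTo n)

next8 : ℕ → ℕ
next8 8 = 1
next8 t = suc t

copyEdges : List ((Side × ℕ) × (Side × ℕ))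
copyEdges =
  concatMap (λ t → ((u , t) , (u , next8 t)) ∷ ((v , t) , (v , next8 t)) ∷ []) (range1 8)
  Data.List.++ map (λ j → ((u , 2 * j) , (v , 2 * j))) (range1 4)

Hgraph : (ℕ → ℕ → Side → ℕ → MV) → ℕ → ℕ → Graph
Hgraph mg r s = record
  { V = MV
  ; _≟V_ = _≟MV_
  ; edges = concatMap (λ b → concatMap (λ i →
              map (λ { ((s₁ , t₁) , (s₂ , t₂)) → (mg b i s₁ t₁ , mg b i s₂ t₂) }) copyEdges)
              (range1 s)) (range1 r)
  }

H : ℕ → ℕ → ℕ → Graph
H 1 r s = Hgraph merge₁ r s
H 2 r s = Hgraph merge₂ r s
H _ r s = Hgraph merge₃ r s

{-# OPTIONS --safe #-}
module Submission where

open import Defs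
open import Data.Bool using (Bool; true; false; if_then_else_; _∨_)
open import Data.Fin using (Fin; toℕ; fromℕ<; cast; opposite; combine; #_)
import Data.Fin as Fin
open import Data.Fin.Patterns using (0F; 1F)
open import Data.Fin.Properties
  using (toℕ<n; toℕ-injective; toℕ-fromℕ<; fromℕ<-toℕ; toℕ-cast; cast-involutive; opposite-prop;
         opposite-involutive; toℕ-combine; remQuot-combine; *↔×; all?)
open import Data.List using (List; []; _∷_; _++_; length; map; concatMap; applyUpTo; upTo; tabulate; lookup; filter; allFin)
import Data.List.Membership.DecPropositional as DecMembership
open import Data.List.Membership.Propositional using (_∈_; find)
open import Data.List.Membership.Propositional.Properties
  using (∈-map⁺; ∈-map⁻; ∈-concatMap⁺; ∈-concatMap⁻; ∈-upTo⁺; ∈-upTo⁻; ∈-lookup; ∈-filter⁺; ∈-deduplicate⁺; ∈-deduplicate⁻)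
open import Data.List.Properties using (length-++; length-map; length-upTo; map-tabulate; tabulate-cong; filter-notAll)
open import Data.List.Relation.Unary.All using (All; []; _∷_)
import Data.List.Relation.Unary.All as All
open import Data.List.Relation.Unary.AllPairs using ([]; _∷_)
open import Data.List.Relation.Unary.Any using (here; there)
import Data.List.Relation.Unary.Any as Any
open import Data.List.Relation.Unary.Any.Properties using (lookup-index)
open import Data.List.Relation.Unary.Unique.DecPropositional.Properties using (deduplicate-!)
open import Data.List.Relation.Unary.Unique.Propositional using (Unique)
open import Data.Nat using (ℕ; zero; suc; _+_; _*_; _∸_; _<_; _≤_; _<?_; _≤?_; z≤n; s≤s; >-nonZero)
import Data.Nat as ℕ
open import Data.Nat.DivMod using (_mod_; m%n<n; m<n⇒m%n≡m)
open import Data.Nat.ListAction using (sum)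
open import Data.Nat.Properties
  using (suc-injective; +-assoc; +-comm; +-identityʳ; *-suc; *-zeroʳ; *-identityˡ; *-comm; *-assoc;
         *-cancelˡ-≡; +-commutativeSemigroup; ≤-antisym; ≤-trans; <-trans; <⇒≢; m<m+n;
         +-monoʳ-<; *-monoʳ-≤; *-mono-≤; m≤n*m; <⇒≤; m+[n∸m]≡n; module ≤-Reasoning)
open import Algebra.Properties.CommutativeSemigroup +-commutativeSemigroup using (interchange)
open import Data.Nat.Tactic.RingSolver using (solve-∀)
open import Data.Product using (_×_; _,_; proj₁; proj₂; ∃; ∃-syntax; uncurry)
open import Data.Product.Properties using () renaming (≡-dec to ×-≡-dec)
open import Data.Sum using (_⊎_; inj₁; inj₂)
open import Data.Vec using (_∷_; [])
import Data.Vec as Vec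
open import Function using (_∘_; id)
open import Function.Bundles using (_↔_; Inverse; mk⇔; mk↔ₛ′)
open import Function.Properties.Inverse using (↔-trans; ↔-sym)
open import Function.Related.TypeIsomorphisms using (×-comm)
open import Relation.Binary.Definitions using (DecidableEquality)
open import Relation.Binary.PropositionalEquality
  using (_≡_; _≢_; refl; sym; trans; cong; cong₂; subst; module ≡-Reasoning)
open import Relation.Nullary using (Dec; yes; no; does; ¬_; contradiction)
open import Relation.Nullary.Decidable using (True; toWitness; _⊎-dec_; _×-dec_; map′; ¬?; dec-false; does-⇔)
open import Relation.Unary using (Decidable)

-- Each copy of C₄(8,2) takes its labels from ten bands of 2n consecutive numbers (n = rs), two edges
-- per band, the copies filling every band in increasing or decreasing order.  Then in every copy each
-- degree-2 vertex sums to 20n+1, the vertices u₂, u₆, v₄, v₈ sum to 29n+1 and u₄, u₈, v₂, v₆ to 31n+2.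
-- A merged vertex of H_m(r,s) collects two degree-2 vertices from each of s copies, so it sums to
-- s(40n+2); the three values are distinct, and adjacent vertices never share one.
-- Conversely, H₂ and H₃ contain triangles.  H₁ is bipartite with sides X ∪ {v₂ₖ} and Y ∪ {u₂ₖ} in each
-- block; with two colours each side is monochromatic, and since every edge meets each side once, both
-- sides sum to the label total of the block while having 2 + 4s vertices each, so the colours coincide.

∑< : ℕ → (ℕ → ℕ) → ℕ
∑< r F = sum (applyUpTo F r)

syntax ∑< r (λ q → F) = ∑[ q < r ] F

∑-cong : ∀ r {F G : ℕ → ℕ} → (∀ q → q < r → F q ≡ G q) → ∑< r F ≡ ∑< r G
∑-cong zero    F≡G = refl
∑-cong (suc r) F≡G = cong₂ _+_ (F≡G 0 (s≤s z≤n)) (∑-cong r λ q q<r → F≡G (suc q) (s≤s q<r))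

∑-const : ∀ r c → ∑[ _ < r ] c ≡ r * c
∑-const zero    c = refl
∑-const (suc r) c = cong (c +_) (∑-const r c)

∑-+ : ∀ r (F G : ℕ → ℕ) → ∑[ q < r ] (F q + G q) ≡ ∑< r F + ∑< r G
∑-+ zero    F G = refl
∑-+ (suc r) F G = trans (cong (F 0 + G 0 +_) (∑-+ r (F ∘ suc) (G ∘ suc))) (interchange (F 0) (G 0) _ _)

∑-zero : ∀ r {F : ℕ → ℕ} → (∀ q → F q ≡ 0) → ∑< r F ≡ 0
∑-zero zero    F≡0 = refl
∑-zero (suc r) F≡0 = cong₂ _+_ (F≡0 0) (∑-zero r (F≡0 ∘ suc))

∑-select : ∀ r {F : ℕ → ℕ} q → q < r → (∀ p → p ≢ q → F p ≡ 0) → ∑< r F ≡ F q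
∑-select (suc r) {F} zero    _         F≡0 =
  trans (cong (F 0 +_) (∑-zero r λ p → F≡0 (suc p) λ ())) (+-identityʳ (F 0))
∑-select (suc r) {F} (suc q) (s≤s q<r) F≡0 =
  cong₂ _+_ (F≡0 0 λ ()) (∑-select r q q<r λ p p≢q → F≡0 (suc p) (p≢q ∘ suc-injective))

sum-map-+ : ∀ {A : Set} (F G : A → ℕ) xs →
  sum (map (λ a → F a + G a) xs) ≡ sum (map F xs) + sum (map G xs)
sum-map-+ F G []       = refl
sum-map-+ F G (x ∷ xs) = trans (cong (F x + G x +_) (sum-map-+ F G xs)) (interchange (F x) (G x) _ _)

sum-map-if : ∀ {A : Set} (B : A → Bool) m xs →
  sum (map (λ a → if B a then m else 0) xs) ≡ sum (map (λ a → if B a then 1 else 0) xs) * m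
sum-map-if B m []       = refl
sum-map-if B m (x ∷ xs) with B x
... | true  = cong (m +_) (sum-map-if B m xs)
... | false = sum-map-if B m xs

sum-map-filter : ∀ {A : Set} {P : A → Set} (P? : Decidable P) (g : A → ℕ) xs →
  sum (map g (filter P? xs)) ≡ sum (map (λ a → if does (P? a) then g a else 0) xs)
sum-map-filter P? g []       = refl
sum-map-filter P? g (x ∷ xs) with does (P? x)
... | true  = cong (g x +_) (sum-map-filter P? g xs)
... | false = sum-map-filter P? g xs

sum-map-zero : ∀ {A : Set} (xs : List A) → sum (map (λ _ → 0) xs) ≡ 0
sum-map-zero []       = refl
sum-map-zero (x ∷ xs) = sum-map-zero xs

∑-sum-map : ∀ {A : Set} r (F : ℕ → A → ℕ) xs →
  ∑[ q < r ] sum (map (F q) xs) ≡ sum (map (λ a → ∑[ q < r ] F q a) xs)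
∑-sum-map r F []       = ∑-zero r λ _ → refl
∑-sum-map r F (x ∷ xs) =
  trans (∑-+ r (λ q → F q x) (λ q → sum (map (F q) xs))) (cong (∑[ q < r ] F q x +_) (∑-sum-map r F xs))

-- Labels and vertex sums of copy k are affine in n, k and k̄ = n − 1 − k.
record Affine : Set where
  constructor affine
  field
    constant nCoef kCoef k̄Coef : ℕ

open Affine

⟦_⟧ : Affine → ℕ → ℕ → ℕ → ℕ
⟦ x ⟧ n k k̄ = constant x + n * nCoef x + k * kCoef x + k̄ * k̄Coef x

_⊕_ : Affine → Affine → Affine
x ⊕ y = affine (constant x + constant y) (nCoef x + nCoef y) (kCoef x + kCoef y) (k̄Coef x + k̄Coef y)

⟦⊕⟧ : ∀ x y n k k̄ → ⟦ x ⊕ y ⟧ n k k̄ ≡ ⟦ x ⟧ n k k̄ + ⟦ y ⟧ n k k̄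
⟦⊕⟧ x y = distrib (constant x) (nCoef x) (kCoef x) (k̄Coef x) (constant y) (nCoef y) (kCoef y) (k̄Coef y)
  where
  distrib : ∀ a b c d a′ b′ c′ d′ n k k̄ → a + a′ + n * (b + b′) + k * (c + c′) + k̄ * (d + d′)
                                          ≡ (a + n * b + k * c + k̄ * d) + (a′ + n * b′ + k * c′ + k̄ * d′)
  distrib = solve-∀

⟦0⟧ : ∀ n k k̄ → ⟦ affine 0 0 0 0 ⟧ n k k̄ ≡ 0
⟦0⟧ = zeros
  where
  zeros : ∀ n k k̄ → 0 + n * 0 + k * 0 + k̄ * 0 ≡ 0
  zeros = solve-∀

⟦⟧-diagonal : ∀ x {a b} → kCoef x ≡ k̄Coef x → nCoef x + kCoef x ≡ a → constant x ≡ b + kCoef x →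
  ∀ k k̄ → ⟦ x ⟧ (suc (k + k̄)) k k̄ ≡ a * suc (k + k̄) + b
⟦⟧-diagonal (affine _ N K _) {b = b} refl refl refl = diagonal b N K
  where
  diagonal : ∀ b N K k k̄ → b + K + suc (k + k̄) * N + k * K + k̄ * K ≡ (N + K) * suc (k + k̄) + b
  diagonal = solve-∀

module Incidence {V : Set} (_≟_ : DecidableEquality V) where

  incident : V → V × V → Bool
  incident x e = does ((x ≟ proj₁ e) ⊎-dec (x ≟ proj₂ e))

  incidenceSum : V → List (V × V) → (ℕ → ℕ) → ℕ
  incidenceSum x []       w = 0
  incidenceSum x (e ∷ es) w = (if incident x e then w 0 else 0) + incidenceSum x es (w ∘ suc)

  incidenceSum-cong : ∀ x es {w w′ : ℕ → ℕ} → (∀ t → t < length es → w t ≡ w′ t) →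
    incidenceSum x es w ≡ incidenceSum x es w′
  incidenceSum-cong x []       w≡w′ = refl
  incidenceSum-cong x (e ∷ es) w≡w′ =
    cong₂ _+_ (cong (λ v → if incident x e then v else 0) (w≡w′ 0 (s≤s z≤n)))
              (incidenceSum-cong x es λ t t<n → w≡w′ (suc t) (s≤s t<n))

  incidenceSum-++ : ∀ x xs ys w →
    incidenceSum x (xs ++ ys) w ≡ incidenceSum x xs w + incidenceSum x ys (w ∘ (length xs +_))
  incidenceSum-++ x []       ys w = refl
  incidenceSum-++ x (e ∷ xs) ys w =
    trans (cong ((if incident x e then w 0 else 0) +_) (incidenceSum-++ x xs ys (w ∘ suc)))
          (sym (+-assoc (if incident x e then w 0 else 0) _ _))

  incidenceSumᴬ : V → List (V × V) → (ℕ → Affine) → Affine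
  incidenceSumᴬ x es A = affine (incidenceSum x es (constant ∘ A)) (incidenceSum x es (nCoef ∘ A))
                                (incidenceSum x es (kCoef ∘ A)) (incidenceSum x es (k̄Coef ∘ A))

  incidenceSum-affine : ∀ x es A n k k̄ →
    incidenceSum x es (λ t → ⟦ A t ⟧ n k k̄) ≡ ⟦ incidenceSumᴬ x es A ⟧ n k k̄
  incidenceSum-affine x []       A n k k̄ = sym (⟦0⟧ n k k̄)
  incidenceSum-affine x (e ∷ es) A n k k̄ with incident x e
  ... | true  = trans (cong (⟦ A 0 ⟧ n k k̄ +_) (incidenceSum-affine x es (A ∘ suc) n k k̄))
                      (sym (⟦⊕⟧ (A 0) (incidenceSumᴬ x es (A ∘ suc)) n k k̄))
  ... | false = incidenceSum-affine x es (A ∘ suc) n k k̄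

  incidenceSum-as-sum : ∀ x es w →
    incidenceSum x es w ≡ sum (tabulate λ i → if incident x (lookup es i) then w (toℕ i) else 0)
  incidenceSum-as-sum x []       w = refl
  incidenceSum-as-sum x (e ∷ es) w = cong (_ +_) (incidenceSum-as-sum x es (w ∘ suc))

  meetCount : List V → V × V → ℕ
  meetCount P e = sum (map (λ c → if incident c e then 1 else 0) P)

  incidenceSum-bipartite : ∀ P es w → All (λ e → meetCount P e ≡ 1) es →
    sum (map (λ c → incidenceSum c es w) P) ≡ ∑< (length es) w
  incidenceSum-bipartite P []       w []              = sum-map-zero P
  incidenceSum-bipartite P (e ∷ es) w (meet≡1 ∷ meets) = begin
    sum (map (λ c → (if incident c e then w 0 else 0) + incidenceSum c es (w ∘ suc)) P)
      ≡⟨ sum-map-+ (λ c → if incident c e then w 0 else 0) (λ c → incidenceSum c es (w ∘ suc)) P ⟩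
    sum (map (λ c → if incident c e then w 0 else 0) P) + sum (map (λ c → incidenceSum c es (w ∘ suc)) P)
      ≡⟨ cong₂ _+_ (trans (sum-map-if (λ c → incident c e) (w 0) P) (cong (_* w 0) meet≡1))
                   (incidenceSum-bipartite P es (w ∘ suc) meets) ⟩
    1 * w 0 + ∑< (length es) (w ∘ suc)
      ≡⟨ cong (_+ ∑< (length es) (w ∘ suc)) (*-identityˡ (w 0)) ⟩
    ∑< (length (e ∷ es)) w ∎
    where open ≡-Reasoning

  incidenceSum-concatMap : ∀ x {blk : ℕ → List (V × V)} c → (∀ a → length (blk a) ≡ c) → ∀ r w →
    incidenceSum x (concatMap blk (range1 r)) w ≡ ∑[ q < r ] incidenceSum x (blk (suc q)) (w ∘ (c * q +_))
  incidenceSum-concatMap x {blk} c |blk|≡c r = go id r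
    where
    go : ∀ g r w → incidenceSum x (concatMap blk (map suc (applyUpTo g r))) w
                 ≡ ∑[ q < r ] incidenceSum x (blk (suc (g q))) (w ∘ (c * q +_))
    go g zero    w = refl
    go g (suc r) w = begin
      incidenceSum x (first ++ rest) w
        ≡⟨ incidenceSum-++ x first rest w ⟩
      incidenceSum x first w + incidenceSum x rest (w ∘ (length first +_))
        ≡⟨ cong₂ _+_ (incidenceSum-cong x first λ t _ → cong (λ o → w (o + t)) (sym (*-zeroʳ c)))
                     (cong (λ l → incidenceSum x rest (w ∘ (l +_))) (|blk|≡c _)) ⟩
      incidenceSum x first (w ∘ (c * 0 +_)) + incidenceSum x rest (w ∘ (c +_))
        ≡⟨ cong (incidenceSum x first (w ∘ (c * 0 +_)) +_) (go (g ∘ suc) r (w ∘ (c +_))) ⟩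
      incidenceSum x first (w ∘ (c * 0 +_)) + ∑[ q < r ] incidenceSum x (blk (suc (g (suc q)))) (w ∘ (c +_) ∘ (c * q +_))
        ≡⟨ cong (incidenceSum x first (w ∘ (c * 0 +_)) +_)
                (∑-cong r λ q _ → incidenceSum-cong x (blk _) λ t _ → cong w (c+[c*q+t] q t)) ⟩
      ∑[ q < suc r ] incidenceSum x (blk (suc (g q))) (w ∘ (c * q +_)) ∎
      where
      open ≡-Reasoning
      first = blk (suc (g 0))
      rest = concatMap blk (map suc (applyUpTo (g ∘ suc) r))
      c+[c*q+t] : ∀ q t → c + (c * q + t) ≡ c * suc q + t
      c+[c*q+t] q t = trans (sym (+-assoc c (c * q) t)) (cong (_+ t) (sym (*-suc c q)))

onEndpoints : ∀ {V W : Set} → (V → W) → V × V → W × W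
onEndpoints g (a , b) = g a , g b

module _ {V W : Set} (_≟V_ : DecidableEquality V) (_≟W_ : DecidableEquality W) (g : V → W) where
  private
    module IV = Incidence _≟V_
    module IW = Incidence _≟W_

  incidenceSum-map-injective : (∀ {a b} → g a ≡ g b → a ≡ b) → ∀ x es w →
    IW.incidenceSum (g x) (map (onEndpoints g) es) w ≡ IV.incidenceSum x es w
  incidenceSum-map-injective g-inj x []            w = refl
  incidenceSum-map-injective g-inj x ((a , b) ∷ es) w =
    cong₂ (λ hit rest → (if hit then w 0 else 0) + rest)
      (cong₂ _∨_ (does-⇔ (mk⇔ g-inj (cong g)) (g x ≟W g a) (x ≟V a))
                 (does-⇔ (mk⇔ g-inj (cong g)) (g x ≟W g b) (x ≟V b)))
      (incidenceSum-map-injective g-inj x es (w ∘ suc))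

  incidenceSum-map-outside : ∀ y → (∀ a → g a ≢ y) → ∀ es w →
    IW.incidenceSum y (map (onEndpoints g) es) w ≡ 0
  incidenceSum-map-outside y y∉ []            w = refl
  incidenceSum-map-outside y y∉ ((a , b) ∷ es) w
    rewrite dec-false (y ≟W g a) (y∉ a ∘ sym) | dec-false (y ≟W g b) (y∉ b ∘ sym) =
    incidenceSum-map-outside y y∉ es (w ∘ suc)

Unique⇒length≤ : ∀ {xs ys : List ℕ} → Unique xs → (∀ {z} → z ∈ xs → z ∈ ys) → length xs ≤ length ys
Unique⇒length≤ {[]} _ _ = z≤n
Unique⇒length≤ {x ∷ xs} {ys} (x∉xs ∷ unique) xs⊆ys =
  ≤-trans (s≤s (Unique⇒length≤ unique xs⊆others))
          (filter-notAll (λ z → ¬? (z ℕ.≟ x)) ys (Any.map (λ { refl x≢x → x≢x refl }) (xs⊆ys (here refl))))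
  where
  xs⊆others : ∀ {z} → z ∈ xs → z ∈ filter (λ z → ¬? (z ℕ.≟ x)) ys
  xs⊆others z∈xs = ∈-filter⁺ (λ z → ¬? (z ℕ.≟ x)) (xs⊆ys (there z∈xs)) λ { refl → All.lookup x∉xs z∈xs refl }

module _ (G : Graph) where
  open Graph G

  Adjacent : V → V → Set
  Adjacent x y = (x , y) ∈ edges ⊎ (y , x) ∈ edges

  proj₁∈vertexList : ∀ {p} → p ∈ edges → proj₁ p ∈ vertexList G
  proj₁∈vertexList p∈ = ∈-concatMap⁺ _ (Any.map (λ { refl → here refl }) p∈)

  proj₂∈vertexList : ∀ {p} → p ∈ edges → proj₂ p ∈ vertexList G
  proj₂∈vertexList p∈ = ∈-concatMap⁺ _ (Any.map (λ { refl → there (here refl) }) p∈)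

  Adjacent-sym : ∀ {x y} → Adjacent x y → Adjacent y x
  Adjacent-sym (inj₁ xy∈) = inj₂ xy∈
  Adjacent-sym (inj₂ yx∈) = inj₁ yx∈

  Adjacent⇒∈vertexList : ∀ {x y} → Adjacent x y → y ∈ vertexList G
  Adjacent⇒∈vertexList (inj₁ xy∈) = proj₂∈vertexList xy∈
  Adjacent⇒∈vertexList (inj₂ yx∈) = proj₁∈vertexList yx∈

  open Incidence _≟V_

  -- Labels indexed by position in the edge list (0 past its end), so that sums split along _++_.
  labelAt : Labeling G → ℕ → ℕ
  labelAt f p with p <? #E G
  ... | yes p<m = lab f (fromℕ< p<m)
  ... | no _    = 0

  labelAt-fromℕ< : ∀ f {p} (p<m : p < #E G) → labelAt f p ≡ lab f (fromℕ< p<m)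
  labelAt-fromℕ< f {p} p<m with p <? #E G
  ... | yes p<m′ = cong (lab f) (toℕ-injective (trans (toℕ-fromℕ< p<m′) (sym (toℕ-fromℕ< p<m))))
  ... | no p≮m   = contradiction p<m p≮m

  lab≡labelAt : ∀ f e → lab f e ≡ labelAt f (toℕ e)
  lab≡labelAt f e = sym (trans (labelAt-fromℕ< f (toℕ<n e)) (cong (lab f) (fromℕ<-toℕ e (toℕ<n e))))

  vsum≡incidenceSum : ∀ f x → vsum G f x ≡ incidenceSum x edges (labelAt f)
  vsum≡incidenceSum f x = begin
    sum (map (lab f) (filter (incident? G x) (allFin (#E G))))
      ≡⟨ sum-map-filter (incident? G x) (lab f) (allFin (#E G)) ⟩
    sum (map (λ e → if incident x (edge G e) then lab f e else 0) (allFin (#E G)))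
      ≡⟨ cong sum (map-tabulate {n = #E G} id (λ e → if incident x (edge G e) then lab f e else 0)) ⟩
    sum (tabulate λ e → if incident x (edge G e) then lab f e else 0)
      ≡⟨ cong sum (tabulate-cong λ e →
           cong (λ l → if incident x (edge G e) then l else 0) (lab≡labelAt f e)) ⟩
    sum (tabulate λ e → if incident x (edge G e) then labelAt f (toℕ e) else 0)
      ≡⟨ incidenceSum-as-sum x edges (labelAt f) ⟨
    incidenceSum x edges (labelAt f) ∎
    where open ≡-Reasoning

  bijection⇒Labeling : ∀ {N} → Fin (#E G) ↔ Fin N → #E G ≡ N → Labeling G
  bijection⇒Labeling {N} π m≡N = record
    { lab       = suc ∘ toℕ ∘ to
    ; lab-inj   = λ {e} {e′} eq → trans (sym (strictlyInverseʳ e))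
                    (trans (cong from (toℕ-injective (suc-injective eq))) (strictlyInverseʳ e′))
    ; lab-range = λ e → s≤s z≤n , subst (suc (toℕ (to e)) ≤_) (sym m≡N) (toℕ<n (to e))
    ; lab-onto  = onto
    }
    where
    open Inverse π
    onto : ∀ k → 1 ≤ k → k ≤ #E G → ∃ λ e → suc (toℕ (to e)) ≡ k
    onto (suc k) _ k<m =
      from (fromℕ< k<N) , cong suc (trans (cong toℕ (strictlyInverseˡ (fromℕ< k<N))) (toℕ-fromℕ< k<N))
      where k<N = subst (k <_) m≡N k<m

  vertexList⁻ : ∀ {x} → x ∈ vertexList G → ∃[ p ] p ∈ edges × (x ≡ proj₁ p ⊎ x ≡ proj₂ p)
  vertexList⁻ x∈ with find (∈-concatMap⁻ (λ p → proj₁ p ∷ proj₂ p ∷ []) x∈)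
  ... | p , p∈ , here x≡ = p , p∈ , inj₁ x≡
  ... | p , p∈ , there (here x≡) = p , p∈ , inj₂ x≡

  module _ (f : Labeling G) where

    3≤numColours : ∀ {x y z} → x ∈ vertexList G → y ∈ vertexList G → z ∈ vertexList G →
      vsum G f x ≢ vsum G f y → vsum G f x ≢ vsum G f z → vsum G f y ≢ vsum G f z →
      3 ≤ numColours G f
    3≤numColours x∈ y∈ z∈ x≢y x≢z y≢z =
      Unique⇒length≤ ((x≢y ∷ x≢z ∷ []) ∷ (y≢z ∷ []) ∷ [] ∷ [])
        λ { (here refl) → ∈-deduplicate⁺ ℕ._≟_ (∈-map⁺ (vsum G f) x∈)
          ; (there (here refl)) → ∈-deduplicate⁺ ℕ._≟_ (∈-map⁺ (vsum G f) y∈)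
          ; (there (there (here refl))) → ∈-deduplicate⁺ ℕ._≟_ (∈-map⁺ (vsum G f) z∈) }

    numColours≤3 : ∀ {a b c} →
      (∀ {x} → x ∈ vertexList G → vsum G f x ≡ a ⊎ vsum G f x ≡ b ⊎ vsum G f x ≡ c) → numColours G f ≤ 3
    numColours≤3 {a} {b} {c} threeValued =
      Unique⇒length≤ (deduplicate-! ℕ._≟_ _) λ v∈ → among (∈-map⁻ (vsum G f) (∈-deduplicate⁻ ℕ._≟_ _ v∈))
      where
      among : ∀ {v} → ∃[ x ] x ∈ vertexList G × v ≡ vsum G f x → v ∈ a ∷ b ∷ c ∷ []
      among (x , x∈ , refl) with threeValued x∈
      ... | inj₁ fx≡a = here fx≡a
      ... | inj₂ (inj₁ fx≡b) = there (here fx≡b)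
      ... | inj₂ (inj₂ fx≡c) = there (there (here fx≡c))

    module _ (antimagic : IsLocalAntimagic G f) where

      edge⇒vsum≢ : ∀ {x y} → (x , y) ∈ edges → vsum G f x ≢ vsum G f y
      edge⇒vsum≢ xy∈ = subst (λ p → vsum G f (proj₁ p) ≢ vsum G f (proj₂ p))
                             (sym (lookup-index xy∈)) (antimagic (Any.index xy∈))

      Adjacent⇒vsum≢ : ∀ {x y} → Adjacent x y → vsum G f x ≢ vsum G f y
      Adjacent⇒vsum≢ (inj₁ xy∈) = edge⇒vsum≢ xy∈
      Adjacent⇒vsum≢ (inj₂ yx∈) = edge⇒vsum≢ yx∈ ∘ sym

      triangle⇒3≤numColours : ∀ {x y z} → Adjacent x y → Adjacent x z → Adjacent y z → 3 ≤ numColours G f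
      triangle⇒3≤numColours xy xz yz =
        3≤numColours (Adjacent⇒∈vertexList (Adjacent-sym xy)) (Adjacent⇒∈vertexList xy) (Adjacent⇒∈vertexList xz)
          (Adjacent⇒vsum≢ xy) (Adjacent⇒vsum≢ xz) (Adjacent⇒vsum≢ yz)

      module TwoColours (fewer : ¬ 3 ≤ numColours G f) {a b} (ab : Adjacent a b) where

        twoColours : ∀ {x} → x ∈ vertexList G → vsum G f x ≡ vsum G f a ⊎ vsum G f x ≡ vsum G f b
        twoColours {x} x∈ with vsum G f x ℕ.≟ vsum G f a | vsum G f x ℕ.≟ vsum G f b
        ... | yes x≡a | _ = inj₁ x≡a
        ... | no _ | yes x≡b = inj₂ x≡b
        ... | no x≢a | no x≢b = contradiction
          (3≤numColours (Adjacent⇒∈vertexList (Adjacent-sym ab)) (Adjacent⇒∈vertexList ab) x∈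
            (Adjacent⇒vsum≢ ab) (x≢a ∘ sym) (x≢b ∘ sym)) fewer

        neighbour : ∀ {x y} → Adjacent x y → vsum G f x ≡ vsum G f a → vsum G f y ≡ vsum G f b
        neighbour xy x≡a with twoColours (Adjacent⇒∈vertexList xy)
        ... | inj₁ y≡a = contradiction (trans x≡a (sym y≡a)) (Adjacent⇒vsum≢ xy)
        ... | inj₂ y≡b = y≡b

  ChiLa≡-intro : ∀ {k} (f : Labeling G) → IsLocalAntimagic G f → numColours G f ≤ k →
    (∀ f → IsLocalAntimagic G f → k ≤ numColours G f) → ChiLa≡ G k
  ChiLa≡-intro f antimagic ≤k lowerBound = (f , antimagic , ≤-antisym ≤k (lowerBound f antimagic)) , lowerBound

-- H_m(r,s) as r·s embedded copies of one merged copy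

length-concatMap-const : ∀ {A B : Set} {blk : A → List B} c → (∀ a → length (blk a) ≡ c) → ∀ xs →
  length (concatMap blk xs) ≡ length xs * c
length-concatMap-const c |blk|≡c []       = refl
length-concatMap-const {blk = blk} c |blk|≡c (x ∷ xs) =
  trans (length-++ (blk x)) (cong₂ _+_ (|blk|≡c x) (length-concatMap-const c |blk|≡c xs))

length-range1 : ∀ r → length (range1 r) ≡ r
length-range1 r = trans (length-map suc (upTo r)) (length-upTo r)

∈-range1⁻ : ∀ {a r} → a ∈ range1 r → ∃[ a₀ ] a₀ < r × a ≡ suc a₀
∈-range1⁻ a∈ with ∈-map⁻ suc a∈
... | a₀ , a₀∈ , refl = a₀ , ∈-upTo⁻ a₀∈ , refl

data Slot : Set where
  plain   : Side → ℕ → Slot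
  mergedX : ℕ → Slot
  mergedY : ℕ → Slot

_≟Slot_ : DecidableEquality Slot
plain σ t ≟Slot plain σ′ t′ =
  map′ (λ (σ≡ , t≡) → cong₂ plain σ≡ t≡) (λ { refl → refl , refl }) ((σ ≟S σ′) ×-dec (t ℕ.≟ t′))
mergedX j ≟Slot mergedX j′ = map′ (cong mergedX) (λ { refl → refl }) (j ℕ.≟ j′)
mergedY j ≟Slot mergedY j′ = map′ (cong mergedY) (λ { refl → refl }) (j ℕ.≟ j′)
plain _ _ ≟Slot mergedX _  = no λ ()
plain _ _ ≟Slot mergedY _  = no λ ()
mergedX _ ≟Slot plain _ _  = no λ ()
mergedX _ ≟Slot mergedY _  = no λ ()
mergedY _ ≟Slot plain _ _  = no λ ()
mergedY _ ≟Slot mergedX _  = no λ ()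

embed : ℕ → ℕ → Slot → MV
embed b i (plain σ t) = orig b i σ t
embed b i (mergedX j) = X b j
embed b i (mergedY j) = Y b j

slotOf : MV → Slot
slotOf (orig _ _ σ t) = plain σ t
slotOf (X _ j)        = mergedX j
slotOf (Y _ j)        = mergedY j

blockOf : MV → ℕ
blockOf (orig b _ _ _) = b
blockOf (X b _)        = b
blockOf (Y b _)        = b

blockOf-embed : ∀ b i c → blockOf (embed b i c) ≡ b
blockOf-embed b i (plain _ _) = refl
blockOf-embed b i (mergedX _) = refl
blockOf-embed b i (mergedY _) = refl

embed-injective : ∀ b i {c c′} → embed b i c ≡ embed b i c′ → c ≡ c′
embed-injective b i {plain _ _} {plain _ _} refl = refl
embed-injective b i {mergedX _} {mergedX _} refl = refl
embed-injective b i {mergedY _} {mergedY _} refl = refl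

MergeMap : Set
MergeMap = ℕ → ℕ → Side → ℕ → MV

-- Hgraph mg r s concatenates the lists copyOf mg b i (definitionally, as copyEdges is concrete).
copyOf : MergeMap → ℕ → ℕ → List (MV × MV)
copyOf mg b i = map (onEndpoints (uncurry (mg b i))) copyEdges

-- slotOf forgets the copy, so the indices 0 0 are arbitrary.
template : MergeMap → List (Slot × Slot)
template mg = map (onEndpoints (slotOf ∘ uncurry (mg 0 0))) copyEdges

Templated : MergeMap → Set
Templated mg = ∀ b i → copyOf mg b i ≡ map (onEndpoints (embed b i)) (template mg)

templated₁ : Templated merge₁
templated₁ _ _ = refl

templated₂ : Templated merge₂
templated₂ _ _ = refl

templated₃ : Templated merge₃
templated₃ _ _ = refl

open Incidence _≟MV_ using (incidenceSum; incidenceSum-concatMap; incidenceSum-cong)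
module SlotIncidence = Incidence _≟Slot_
open SlotIncidence using () renaming (incidenceSum to slotSum)

length-block : ∀ mg s b → length (concatMap (copyOf mg b) (range1 s)) ≡ s * 20
length-block mg s b =
  trans (length-concatMap-const 20 (λ _ → refl) (range1 s)) (cong (_* 20) (length-range1 s))

#E-H : ∀ mg r s → #E (Hgraph mg r s) ≡ r * s * 20
#E-H mg r s = trans (length-concatMap-const (s * 20) (length-block mg s) (range1 r))
                    (trans (cong (_* (s * 20)) (length-range1 r)) (sym (*-assoc r s 20)))

module _ (mg : MergeMap) (r s : ℕ) where

  -- Copy (b+1, i+1) occupies positions 20(sb+i), …, 20(sb+i)+19 of the edge list of Hgraph mg r s.
  copyWeights : (ℕ → ℕ) → ℕ → ℕ → ℕ → ℕ
  copyWeights w b i t = w (20 * (s * b + i) + t)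

  incidenceSum-H : ∀ x w → incidenceSum x (Graph.edges (Hgraph mg r s)) w
    ≡ ∑[ b < r ] ∑[ i < s ] incidenceSum x (copyOf mg (suc b) (suc i)) (copyWeights w b i)
  incidenceSum-H x w =
    trans (incidenceSum-concatMap x (s * 20) (length-block mg s) r w)
          (∑-cong r λ b _ →
             trans (incidenceSum-concatMap x 20 (λ _ → refl) s (w ∘ (s * 20 * b +_)))
                   (∑-cong s λ i _ → incidenceSum-cong x (copyOf mg (suc b) (suc i)) λ t _ → cong w (offset s b i t)))
    where
    offset : ∀ s b i t → s * 20 * b + (20 * i + t) ≡ 20 * (s * b + i) + t
    offset = solve-∀

module _ (mg : MergeMap) (templated : Templated mg) {r s : ℕ} where

  ∈-edges-H⁻ : ∀ {p} → p ∈ Graph.edges (Hgraph mg r s) →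
    ∃[ b ] ∃[ i ] ∃[ e ] b < r × i < s × e ∈ template mg × p ≡ onEndpoints (embed (suc b) (suc i)) e
  ∈-edges-H⁻ {p} p∈ with find (∈-concatMap⁻ (λ b → concatMap (copyOf mg b) (range1 s)) {xs = range1 r} p∈)
  ... | b′ , b′∈ , p∈block with find (∈-concatMap⁻ (copyOf mg b′) {xs = range1 s} p∈block)
  ... | i′ , i′∈ , p∈copy with ∈-range1⁻ b′∈ | ∈-range1⁻ i′∈
  ... | b , b<r , refl | i , i<s , refl
    with ∈-map⁻ (onEndpoints (embed (suc b) (suc i))) (subst (p ∈_) (templated (suc b) (suc i)) p∈copy)
  ... | e , e∈ , p≡ = b , i , e , b<r , i<s , e∈ , p≡

  ∈-edges-H⁺ : ∀ {b i e} → b < r → i < s → e ∈ template mg →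
    onEndpoints (embed (suc b) (suc i)) e ∈ Graph.edges (Hgraph mg r s)
  ∈-edges-H⁺ {b} {i} {e} b<r i<s e∈ =
    ∈-concatMap⁺ (λ b → concatMap (copyOf mg b) (range1 s)) (Any.map (λ { refl → copy∈block }) (∈-map⁺ suc (∈-upTo⁺ b<r)))
    where
    e∈copy : onEndpoints (embed (suc b) (suc i)) e ∈ copyOf mg (suc b) (suc i)
    e∈copy = subst (onEndpoints (embed (suc b) (suc i)) e ∈_) (sym (templated (suc b) (suc i)))
                   (∈-map⁺ (onEndpoints (embed (suc b) (suc i))) e∈)
    copy∈block = ∈-concatMap⁺ (copyOf mg (suc b)) (Any.map (λ { refl → e∈copy }) (∈-map⁺ suc (∈-upTo⁺ i<s)))

module CopyDecomposition (mg : MergeMap) (templated : Templated mg) (r s : ℕ) (f : Labeling (Hgraph mg r s))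
  where

  labels : ℕ → ℕ
  labels = labelAt (Hgraph mg r s) f

  private
    embeddedCopy : ℕ → ℕ → List (MV × MV)
    embeddedCopy b i = map (onEndpoints (embed b i)) (template mg)

    copySum-injective : ∀ b i c w → incidenceSum (embed b i c) (embeddedCopy b i) w ≡ slotSum c (template mg) w
    copySum-injective b i c =
      incidenceSum-map-injective _≟Slot_ _≟MV_ (embed b i) (embed-injective b i) c (template mg)

    copySum-outside : ∀ b i x → (∀ c → embed b i c ≢ x) → ∀ w → incidenceSum x (embeddedCopy b i) w ≡ 0
    copySum-outside b i x x∉ = incidenceSum-map-outside _≟Slot_ _≟MV_ (embed b i) x x∉ (template mg)

    vsum-block : ∀ {b₀} x → blockOf x ≡ suc b₀ → b₀ < r → vsum (Hgraph mg r s) f x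
      ≡ ∑[ i < s ] incidenceSum x (embeddedCopy (suc b₀) (suc i)) (copyWeights mg r s labels b₀ i)
    vsum-block {b₀} x x∈b₀ b₀<r = begin
      vsum (Hgraph mg r s) f x
        ≡⟨ vsum≡incidenceSum (Hgraph mg r s) f x ⟩
      incidenceSum x (Graph.edges (Hgraph mg r s)) labels
        ≡⟨ incidenceSum-H mg r s x labels ⟩
      ∑[ b < r ] ∑[ i < s ] incidenceSum x (copyOf mg (suc b) (suc i)) (copyWeights mg r s labels b i)
        ≡⟨ ∑-cong r (λ b _ → ∑-cong s λ i _ →
             cong (λ es → incidenceSum x es (copyWeights mg r s labels b i)) (templated (suc b) (suc i))) ⟩
      ∑[ b < r ] ∑[ i < s ] incidenceSum x (embeddedCopy (suc b) (suc i)) (copyWeights mg r s labels b i)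
        ≡⟨ ∑-select r b₀ b₀<r (λ b b≢b₀ → ∑-zero s λ i →
             copySum-outside (suc b) (suc i) x (other-block b≢b₀) (copyWeights mg r s labels b i)) ⟩
      ∑[ i < s ] incidenceSum x (embeddedCopy (suc b₀) (suc i)) (copyWeights mg r s labels b₀ i) ∎
      where
      open ≡-Reasoning
      other-block : ∀ {b i} → b ≢ b₀ → ∀ c → embed (suc b) i c ≢ x
      other-block {b} {i} b≢b₀ c eq =
        b≢b₀ (suc-injective (trans (sym (blockOf-embed (suc b) i c)) (trans (cong blockOf eq) x∈b₀)))

  vsum-plain : ∀ {b₀ i₀} σ t → b₀ < r → i₀ < s → vsum (Hgraph mg r s) f (orig (suc b₀) (suc i₀) σ t)
    ≡ slotSum (plain σ t) (template mg) (copyWeights mg r s labels b₀ i₀)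
  vsum-plain {b₀} {i₀} σ t b₀<r i₀<s =
    trans (vsum-block x refl b₀<r)
          (trans (∑-select s i₀ i₀<s λ i i≢i₀ →
                    copySum-outside (suc b₀) (suc i) x (other-copy i≢i₀) (copyWeights mg r s labels b₀ i))
                 (copySum-injective (suc b₀) (suc i₀) (plain σ t) (copyWeights mg r s labels b₀ i₀)))
    where
    x = orig (suc b₀) (suc i₀) σ t
    other-copy : ∀ {i} → i ≢ i₀ → ∀ c → embed (suc b₀) (suc i) c ≢ x
    other-copy i≢i₀ (plain _ _) refl = i≢i₀ refl

  vsum-merged : ∀ {b₀} c → (∀ i → embed (suc b₀) (suc i) c ≡ embed (suc b₀) 1 c) → b₀ < r →
    vsum (Hgraph mg r s) f (embed (suc b₀) 1 c) ≡ ∑[ i < s ] slotSum c (template mg) (copyWeights mg r s labels b₀ i)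
  vsum-merged {b₀} c copy-independent b₀<r =
    trans (vsum-block (embed (suc b₀) 1 c) (blockOf-embed (suc b₀) 1 c) b₀<r)
          (∑-cong s λ i _ →
             trans (cong (λ x → incidenceSum x (embeddedCopy (suc b₀) (suc i)) (copyWeights mg r s labels b₀ i))
                         (sym (copy-independent i)))
                   (copySum-injective (suc b₀) (suc i) c (copyWeights mg r s labels b₀ i)))

cast↔ : ∀ {m n} → m ≡ n → Fin m ↔ Fin n
cast↔ m≡n = mk↔ₛ′ (cast m≡n) (cast (sym m≡n)) (cast-involutive m≡n (sym m≡n)) (cast-involutive (sym m≡n) m≡n)

data Orientation : Set where
  ascending descending : Orientation

-- How the two edges w = 0, 1 of band q share the labels 2nq+1, …, 2nq+2n among the n copies: with
-- halves edge w of copy k gets 2nq + wn + 1 + κ, with alternating it gets 2nq + 2κ + w + 1, where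
-- κ = k if its orientation is ascending and κ = k̄ = n − 1 − k if it is descending.
data Layout : Set where
  halves      : Orientation → Orientation → Layout
  alternating : Orientation → Layout

orientationOf : Layout → Fin 2 → Orientation
orientationOf (halves o₀ o₁) 0F = o₀
orientationOf (halves o₀ o₁) 1F = o₁
orientationOf (alternating o) _ = o

orientedAffine : Orientation → ℕ → ℕ → ℕ → Affine
orientedAffine ascending  a b m = affine a b m 0
orientedAffine descending a b m = affine a b 0 m

layoutAffine : Layout → Fin 2 → Affine
layoutAffine L@(halves _ _)  w = orientedAffine (orientationOf L w) 0 (toℕ w) 1
layoutAffine (alternating o) w = orientedAffine o (toℕ w) 0 2

module _ {n : ℕ} where

  orient : Orientation → Fin n → Fin n
  orient ascending  = id
  orient descending = opposite

  orient-involutive : ∀ o k → orient o (orient o k) ≡ k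
  orient-involutive ascending  k = refl
  orient-involutive descending k = opposite-involutive k

  ⟦orientedAffine⟧ : ∀ o a b m k →
    ⟦ orientedAffine o a b m ⟧ n (toℕ k) (n ∸ suc (toℕ k)) ≡ a + n * b + m * toℕ (orient o k)
  ⟦orientedAffine⟧ ascending  a b m k = shape a b m n (toℕ k) (n ∸ suc (toℕ k))
    where
    shape : ∀ a b m n k k̄ → a + n * b + k * m + k̄ * 0 ≡ a + n * b + m * k
    shape = solve-∀
  ⟦orientedAffine⟧ descending a b m k =
    trans (shape a b m n (toℕ k) (n ∸ suc (toℕ k))) (cong (λ k̄ → a + n * b + m * k̄) (sym (opposite-prop k)))
    where
    shape : ∀ a b m n k k̄ → a + n * b + k * 0 + k̄ * m ≡ a + n * b + m * k̄
    shape = solve-∀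

  reorient : Layout → Fin 2 × Fin n → Fin 2 × Fin n
  reorient L (w , k) = w , orient (orientationOf L w) k

  reorient-involutive : ∀ L wk → reorient L (reorient L wk) ≡ wk
  reorient-involutive L (w , k) = cong (w ,_) (orient-involutive (orientationOf L w) k)

  layout : Layout → (Fin 2 × Fin n) ↔ Fin (2 * n)
  layout L = ↔-trans (mk↔ₛ′ (reorient L) (reorient L) (reorient-involutive L) (reorient-involutive L)) (shape L)
    where
    shape : Layout → (Fin 2 × Fin n) ↔ Fin (2 * n)
    shape (halves _ _)    = ↔-sym *↔×
    shape (alternating _) = ↔-trans (×-comm _ _) (↔-trans (↔-sym *↔×) (cast↔ (*-comm n 2)))

  toℕ-layout : ∀ L w k →
    toℕ (Inverse.to (layout L) (w , k)) ≡ ⟦ layoutAffine L w ⟧ n (toℕ k) (n ∸ suc (toℕ k))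
  toℕ-layout L@(halves _ _) w k = begin
    toℕ (combine w (orient o k))        ≡⟨ toℕ-combine w (orient o k) ⟩
    n * toℕ w + toℕ (orient o k)        ≡⟨ cong (n * toℕ w +_) (*-identityˡ (toℕ (orient o k))) ⟨
    n * toℕ w + 1 * toℕ (orient o k)    ≡⟨ ⟦orientedAffine⟧ o 0 (toℕ w) 1 k ⟨
    ⟦ layoutAffine L w ⟧ n (toℕ k) (n ∸ suc (toℕ k)) ∎
    where
    open ≡-Reasoning
    o = orientationOf L w
  toℕ-layout (alternating o) w k = begin
    toℕ (cast (*-comm n 2) (combine (orient o k) w))  ≡⟨ toℕ-cast (*-comm n 2) (combine (orient o k) w) ⟩
    toℕ (combine (orient o k) w)                      ≡⟨ toℕ-combine (orient o k) w ⟩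
    2 * toℕ (orient o k) + toℕ w                      ≡⟨ shape (toℕ w) n (toℕ (orient o k)) ⟩
    toℕ w + n * 0 + 2 * toℕ (orient o k)              ≡⟨ ⟦orientedAffine⟧ o (toℕ w) 0 2 k ⟨
    ⟦ layoutAffine (alternating o) w ⟧ n (toℕ k) (n ∸ suc (toℕ k)) ∎
    where
    open ≡-Reasoning
    shape : ∀ w n x → 2 * x + w ≡ w + n * 0 + 2 * x
    shape = solve-∀

-- Edge j of a copy, in the order of copyEdges, is edge w of band q, where (q , w) = bandOf j.
bandOf : Fin 20 → Fin 10 × Fin 2
bandOf = Vec.lookup
  ( (# 5 , # 0) ∷ (# 6 , # 0) ∷ (# 0 , # 0) ∷ (# 0 , # 1) ∷ (# 9 , # 1) ∷ (# 9 , # 0) ∷ (# 4 , # 0)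
  ∷ (# 3 , # 0) ∷ (# 5 , # 1) ∷ (# 6 , # 1) ∷ (# 7 , # 0) ∷ (# 7 , # 1) ∷ (# 2 , # 1) ∷ (# 2 , # 0)
  ∷ (# 4 , # 1) ∷ (# 3 , # 1) ∷ (# 8 , # 1) ∷ (# 1 , # 1) ∷ (# 1 , # 0) ∷ (# 8 , # 0) ∷ [])

edgeOf : Fin 10 × Fin 2 → Fin 20
edgeOf (q , w) = Vec.lookup (Vec.lookup
  ( (# 2 ∷ # 3 ∷ []) ∷ (# 18 ∷ # 17 ∷ []) ∷ (# 13 ∷ # 12 ∷ []) ∷ (# 7 ∷ # 15 ∷ [])
  ∷ (# 6 ∷ # 14 ∷ []) ∷ (# 0 ∷ # 8 ∷ []) ∷ (# 1 ∷ # 9 ∷ []) ∷ (# 10 ∷ # 11 ∷ [])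
  ∷ (# 19 ∷ # 16 ∷ []) ∷ (# 5 ∷ # 4 ∷ []) ∷ []) q) w

bandLayout : Fin 10 → Layout
bandLayout = Vec.lookup
  ( alternating descending ∷ halves ascending descending ∷ alternating ascending
  ∷ halves descending descending ∷ halves descending descending ∷ halves ascending ascending
  ∷ halves ascending ascending ∷ alternating descending ∷ halves descending ascending
  ∷ alternating ascending ∷ [])

edgeOf-bandOf : ∀ j → edgeOf (bandOf j) ≡ j
edgeOf-bandOf = toWitness {a? = all? λ j → edgeOf (bandOf j) Fin.≟ j} _

bandOf-edgeOf : ∀ q w → bandOf (edgeOf (q , w)) ≡ (q , w)
bandOf-edgeOf =
  toWitness {a? = all? λ q → all? λ w → ×-≡-dec Fin._≟_ Fin._≟_ (bandOf (edgeOf (q , w))) (q , w)} _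

module _ {n : ℕ} where

  edgePermutation : (Fin n × Fin 20) ↔ (Fin 10 × Fin (2 * n))
  edgePermutation = mk↔ₛ′ to from to∘from from∘to
    where
    place : Fin 10 × Fin 2 → Fin n → Fin 10 × Fin (2 * n)
    place (q , w) k = q , Inverse.to (layout (bandLayout q)) (w , k)
    to : Fin n × Fin 20 → Fin 10 × Fin (2 * n)
    to (k , j) = place (bandOf j) k
    from : Fin 10 × Fin (2 * n) → Fin n × Fin 20
    from (q , T) = proj₂ wk , edgeOf (q , proj₁ wk)
      where wk = Inverse.from (layout (bandLayout q)) T
    to∘from : ∀ qT → to (from qT) ≡ qT
    to∘from (q , T) = trans (cong (λ qw → place qw (proj₂ wk)) (bandOf-edgeOf q (proj₁ wk)))
                            (cong (q ,_) (Inverse.strictlyInverseˡ (layout (bandLayout q)) T))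
      where wk = Inverse.from (layout (bandLayout q)) T
    from∘to : ∀ kj → from (to kj) ≡ kj
    from∘to (k , j) =
      trans (cong (λ wk → proj₂ wk , edgeOf (proj₁ (bandOf j) , proj₁ wk))
                  (Inverse.strictlyInverseʳ (layout (bandLayout (proj₁ (bandOf j)))) (proj₂ (bandOf j) , k)))
            (cong (k ,_) (edgeOf-bandOf j))

  labelPermutation : Fin (n * 20) ↔ Fin (10 * (2 * n))
  labelPermutation = ↔-trans *↔× (↔-trans edgePermutation (↔-sym *↔×))

labelAffine : Fin 20 → Affine
labelAffine j = affine 1 (2 * toℕ q) 0 0 ⊕ layoutAffine (bandLayout q) w
  where q = proj₁ (bandOf j); w = proj₂ (bandOf j)

suc-toℕ-labelPermutation : ∀ {n} (k : Fin n) j →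
  suc (toℕ (Inverse.to (labelPermutation {n}) (combine k j))) ≡ ⟦ labelAffine j ⟧ n (toℕ k) (n ∸ suc (toℕ k))
suc-toℕ-labelPermutation {n} k j = begin
  suc (toℕ (Inverse.to (labelPermutation {n}) (combine k j)))
    ≡⟨ cong (λ kj → suc (toℕ (uncurry combine (Inverse.to (edgePermutation {n}) kj)))) (remQuot-combine k j) ⟩
  suc (toℕ (combine q T))
    ≡⟨ cong suc (toℕ-combine q T) ⟩
  suc (2 * n * toℕ q + toℕ T)
    ≡⟨ shape n (toℕ q) (toℕ k) k̄ (toℕ T) ⟩
  ⟦ affine 1 (2 * toℕ q) 0 0 ⟧ n (toℕ k) k̄ + toℕ T
    ≡⟨ cong (⟦ affine 1 (2 * toℕ q) 0 0 ⟧ n (toℕ k) k̄ +_) (toℕ-layout (bandLayout q) w k) ⟩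
  ⟦ affine 1 (2 * toℕ q) 0 0 ⟧ n (toℕ k) k̄ + ⟦ layoutAffine (bandLayout q) w ⟧ n (toℕ k) k̄
    ≡⟨ ⟦⊕⟧ (affine 1 (2 * toℕ q) 0 0) (layoutAffine (bandLayout q) w) n (toℕ k) k̄ ⟨
  ⟦ labelAffine j ⟧ n (toℕ k) k̄ ∎
  where
  open ≡-Reasoning
  q = proj₁ (bandOf j)
  w = proj₂ (bandOf j)
  T = Inverse.to (layout (bandLayout q)) (w , k)
  k̄ = n ∸ suc (toℕ k)
  shape : ∀ n q k k̄ t → suc (2 * n * q + t) ≡ 1 + n * (2 * q) + k * 0 + k̄ * 0 + t
  shape = solve-∀

-- Upper bound

data Colour : Set where
  α β γ : Colour

_≟Colour_ : DecidableEquality Colour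
α ≟Colour α = yes refl
β ≟Colour β = yes refl
γ ≟Colour γ = yes refl
α ≟Colour β = no λ ()
α ≟Colour γ = no λ ()
β ≟Colour α = no λ ()
β ≟Colour γ = no λ ()
γ ≟Colour α = no λ ()
γ ≟Colour β = no λ ()

-- Odd t never occurs: those vertices are merged in all three graphs.
colour : Slot → Colour
colour (plain u t) = if (t ℕ.≡ᵇ 2) ∨ (t ℕ.≡ᵇ 6) then α else β
colour (plain v t) = if (t ℕ.≡ᵇ 4) ∨ (t ℕ.≡ᵇ 8) then α else β
colour (mergedX _) = γ
colour (mergedY _) = γ

colour-plain : ∀ σ t → colour (plain σ t) ≡ α ⊎ colour (plain σ t) ≡ β
colour-plain u t with (t ℕ.≡ᵇ 2) ∨ (t ℕ.≡ᵇ 6)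
... | true  = inj₁ refl
... | false = inj₂ refl
colour-plain v t with (t ℕ.≡ᵇ 4) ∨ (t ℕ.≡ᵇ 8)
... | true  = inj₁ refl
... | false = inj₂ refl

slope intercept : Colour → ℕ
slope α = 29
slope β = 31
slope γ = 40
intercept α = 1
intercept β = 2
intercept γ = 2

copyValue : ℕ → Colour → ℕ
copyValue n c = slope c * n + intercept c

colourValue : ℕ → ℕ → Colour → ℕ
colourValue s n γ = s * copyValue n γ
colourValue s n c = copyValue n c

slots : List Slot
slots = plain u 2 ∷ plain u 4 ∷ plain u 6 ∷ plain u 8 ∷ plain v 2 ∷ plain v 4 ∷ plain v 6 ∷ plain v 8
      ∷ mergedX 1 ∷ mergedX 2 ∷ mergedY 1 ∷ mergedY 2 ∷ []

copyLabels : ℕ → ℕ → ℕ → ℕ → ℕ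
copyLabels n k k̄ t = ⟦ labelAffine (t mod 20) ⟧ n k k̄

slotAffine : MergeMap → Slot → Affine
slotAffine mg c = SlotIncidence.incidenceSumᴬ c (template mg) (labelAffine ∘ (_mod 20))

Fits : Affine → Colour → Set
Fits x c = kCoef x ≡ k̄Coef x × nCoef x + kCoef x ≡ slope c × constant x ≡ intercept c + kCoef x

fits? : ∀ x c → Dec (Fits x c)
fits? x c =
  (kCoef x ℕ.≟ k̄Coef x) ×-dec (nCoef x + kCoef x ℕ.≟ slope c) ×-dec (constant x ℕ.≟ intercept c + kCoef x)

open DecMembership _≟Slot_ using (_∈?_)

record Balanced (mg : MergeMap) : Set where
  field
    templated  : Templated mg
    endpoints  : All (λ e → proj₁ e ∈ slots × proj₂ e ∈ slots) (template mg)
    proper     : All (λ e → colour (proj₁ e) ≢ colour (proj₂ e)) (template mg)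
    copySums   : All (λ c → Fits (slotAffine mg c) (colour c)) slots

-- The implicit arguments are trivial once the three finite checks are evaluated.
balancedByEvaluation : ∀ mg → Templated mg →
  {_ : True (All.all? (λ e → (proj₁ e ∈? slots) ×-dec (proj₂ e ∈? slots)) (template mg))} →
  {_ : True (All.all? (λ e → ¬? (colour (proj₁ e) ≟Colour colour (proj₂ e))) (template mg))} →
  {_ : True (All.all? (λ c → fits? (slotAffine mg c) (colour c)) slots)} →
  Balanced mg
balancedByEvaluation mg templated {endpoints} {proper} {copySums} = record
  { templated = templated
  ; endpoints = toWitness endpoints
  ; proper    = toWitness proper
  ; copySums  = toWitness copySums
  }

balanced₁ : Balanced merge₁
balanced₁ = balancedByEvaluation merge₁ templated₁

balanced₂ : Balanced merge₂
balanced₂ = balancedByEvaluation merge₂ templated₂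

balanced₃ : Balanced merge₃
balanced₃ = balancedByEvaluation merge₃ templated₃

α<β : ∀ n → copyValue n α < copyValue n β
α<β n = subst (29 * n + 1 <_) (gap n) (m<m+n (29 * n + 1) (s≤s z≤n))
  where
  gap : ∀ n → 29 * n + 1 + suc (2 * n) ≡ 31 * n + 2
  gap = solve-∀

β<γ : ∀ {s n} → 0 < s → 0 < n → copyValue n β < colourValue s n γ
β<γ {s} {n} 0<s 0<n =
  ≤-trans (subst (31 * n + 2 <_) (gap n) (m<m+n (31 * n + 2) (≤-trans (s≤s z≤n) (*-monoʳ-≤ 9 0<n))))
          (m≤n*m (40 * n + 2) s {{>-nonZero 0<s}})
  where
  gap : ∀ n → 31 * n + 2 + 9 * n ≡ 40 * n + 2
  gap = solve-∀

colourValue-injective : ∀ {s n x y} → 0 < s → 0 < n → colourValue s n x ≡ colourValue s n y → x ≡ y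
colourValue-injective {x = α} {α} _ _ _ = refl
colourValue-injective {x = β} {β} _ _ _ = refl
colourValue-injective {x = γ} {γ} _ _ _ = refl
colourValue-injective {n = n} {α} {β} _ _ eq = contradiction eq (<⇒≢ (α<β n))
colourValue-injective {n = n} {β} {α} _ _ eq = contradiction (sym eq) (<⇒≢ (α<β n))
colourValue-injective {n = n} {α} {γ} 0<s 0<n eq = contradiction eq (<⇒≢ (<-trans (α<β n) (β<γ 0<s 0<n)))
colourValue-injective {n = n} {γ} {α} 0<s 0<n eq = contradiction (sym eq) (<⇒≢ (<-trans (α<β n) (β<γ 0<s 0<n)))
colourValue-injective {n = n} {β} {γ} 0<s 0<n eq = contradiction eq (<⇒≢ (β<γ 0<s 0<n))
colourValue-injective {n = n} {γ} {β} 0<s 0<n eq = contradiction (sym eq) (<⇒≢ (β<γ 0<s 0<n))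

copyValue≡colourValue : ∀ s n σ t → copyValue n (colour (plain σ t)) ≡ colourValue s n (colour (plain σ t))
copyValue≡colourValue s n σ t with colour (plain σ t) | colour-plain σ t
... | _ | inj₁ refl = refl
... | _ | inj₂ refl = refl

copyPosition< : ∀ {n k t} → k < n → t < 20 → 20 * k + t < n * 20
copyPosition< {n} {k} {t} k<n t<20 = begin-strict
  20 * k + t  <⟨ +-monoʳ-< (20 * k) t<20 ⟩
  20 * k + 20 ≡⟨ +-comm (20 * k) 20 ⟩
  20 + 20 * k ≡⟨ *-suc 20 k ⟨
  20 * suc k  ≤⟨ *-monoʳ-≤ 20 k<n ⟩
  20 * n      ≡⟨ *-comm 20 n ⟩
  n * 20      ∎
  where open ≤-Reasoning

copyIndex< : ∀ {r s b i} → b < r → i < s → s * b + i < r * s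
copyIndex< {r} {s} {b} {i} b<r i<s = begin-strict
  s * b + i  <⟨ +-monoʳ-< (s * b) i<s ⟩
  s * b + s  ≡⟨ +-comm (s * b) s ⟩
  s + s * b  ≡⟨ *-suc s b ⟨
  s * suc b  ≤⟨ *-monoʳ-≤ s b<r ⟩
  s * r      ≡⟨ *-comm s r ⟩
  r * s      ∎
  where open ≤-Reasoning

toℕ-mod : ∀ {t} → t < 20 → toℕ (t mod 20) ≡ t
toℕ-mod {t} t<20 = trans (toℕ-fromℕ< (m%n<n t 20)) (m<n⇒m%n≡m t<20)

module Construction (mg : MergeMap) (balanced : Balanced mg) (r s : ℕ) (0<r : 0 < r) (0<s : 0 < s) where
  open Balanced balanced

  private
    n : ℕ
    n = r * s
    0<n : 0 < n
    0<n = *-mono-≤ 0<r 0<s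

  labeling : Labeling (Hgraph mg r s)
  labeling = bijection⇒Labeling (Hgraph mg r s) (↔-trans (cast↔ (#E-H mg r s)) (labelPermutation {n}))
                                   (trans (#E-H mg r s) (regroup n))
    where
    regroup : ∀ n → n * 20 ≡ 10 * (2 * n)
    regroup = solve-∀

  open CopyDecomposition mg templated r s labeling

  labelAt-copy : ∀ {k t} → k < n → t < 20 →
    labelAt (Hgraph mg r s) labeling (20 * k + t) ≡ copyLabels n k (n ∸ suc k) t
  labelAt-copy {k} {t} k<n t<20 = begin
    labelAt (Hgraph mg r s) labeling (20 * k + t)
      ≡⟨ labelAt-fromℕ< (Hgraph mg r s) labeling p<#E ⟩
    suc (toℕ (Inverse.to (labelPermutation {n}) (cast (#E-H mg r s) (fromℕ< p<#E))))
      ≡⟨ cong (suc ∘ toℕ ∘ Inverse.to (labelPermutation {n})) (toℕ-injective position) ⟩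
    suc (toℕ (Inverse.to (labelPermutation {n}) (combine (fromℕ< k<n) (t mod 20))))
      ≡⟨ suc-toℕ-labelPermutation (fromℕ< k<n) (t mod 20) ⟩
    ⟦ labelAffine (t mod 20) ⟧ n (toℕ (fromℕ< k<n)) (n ∸ suc (toℕ (fromℕ< k<n)))
      ≡⟨ cong (λ k → ⟦ labelAffine (t mod 20) ⟧ n k (n ∸ suc k)) (toℕ-fromℕ< k<n) ⟩
    copyLabels n k (n ∸ suc k) t ∎
    where
    open ≡-Reasoning
    p<#E : 20 * k + t < #E (Hgraph mg r s)
    p<#E = subst (20 * k + t <_) (sym (#E-H mg r s)) (copyPosition< k<n t<20)
    position : toℕ (cast (#E-H mg r s) (fromℕ< p<#E)) ≡ toℕ (combine (fromℕ< k<n) (t mod 20))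
    position = begin
      toℕ (cast (#E-H mg r s) (fromℕ< p<#E))      ≡⟨ toℕ-cast (#E-H mg r s) (fromℕ< p<#E) ⟩
      toℕ (fromℕ< p<#E)                           ≡⟨ toℕ-fromℕ< p<#E ⟩
      20 * k + t                                  ≡⟨ cong₂ (λ a b → 20 * a + b) (toℕ-fromℕ< k<n) (toℕ-mod t<20) ⟨
      20 * toℕ (fromℕ< k<n) + toℕ (t mod 20)      ≡⟨ toℕ-combine (fromℕ< k<n) (t mod 20) ⟨
      toℕ (combine (fromℕ< k<n) (t mod 20))       ∎

  copySum : (w : ℕ → ℕ) → (∀ {k t} → k < n → t < 20 → w (20 * k + t) ≡ copyLabels n k (n ∸ suc k) t) →
    ∀ {c b i} → c ∈ slots → b < r → i < s →
    slotSum c (template mg) (copyWeights mg r s w b i) ≡ copyValue n (colour c)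
  copySum w w-copy {c} {b} {i} c∈ b<r i<s = begin
    slotSum c (template mg) (copyWeights mg r s w b i)
      ≡⟨ SlotIncidence.incidenceSum-cong c (template mg) (λ t t<20 → w-copy k<n t<20) ⟩
    slotSum c (template mg) (copyLabels n k k̄)
      ≡⟨ SlotIncidence.incidenceSum-affine c (template mg) (labelAffine ∘ (_mod 20)) n k k̄ ⟩
    ⟦ slotAffine mg c ⟧ n k k̄
      ≡⟨ subst (λ N → ⟦ slotAffine mg c ⟧ N k k̄ ≡ copyValue N (colour c)) n≡
               (⟦⟧-diagonal (slotAffine mg c) K≡K̄ slope≡ intercept≡ k k̄) ⟩
    copyValue n (colour c) ∎
    where
    open ≡-Reasoning
    k = s * b + i
    k̄ = n ∸ suc k
    k<n : k < n
    k<n = copyIndex< b<r i<s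
    n≡ : suc (k + k̄) ≡ n
    n≡ = m+[n∸m]≡n k<n
    fits = All.lookup copySums c∈
    K≡K̄ = proj₁ fits
    slope≡ = proj₁ (proj₂ fits)
    intercept≡ = proj₂ (proj₂ fits)

  vertexValue : ∀ {c b i} → c ∈ slots → b < r → i < s →
    vsum (Hgraph mg r s) labeling (embed (suc b) (suc i) c) ≡ colourValue s n (colour c)
  vertexValue {plain σ t} c∈ b<r i<s =
    trans (vsum-plain σ t b<r i<s)
          (trans (copySum labels labelAt-copy c∈ b<r i<s) (copyValue≡colourValue s n σ t))
  vertexValue {mergedX j} c∈ b<r i<s =
    trans (vsum-merged (mergedX j) (λ _ → refl) b<r)
          (trans (∑-cong s λ i i<s → copySum labels labelAt-copy c∈ b<r i<s) (∑-const s (copyValue n γ)))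
  vertexValue {mergedY j} c∈ b<r i<s =
    trans (vsum-merged (mergedY j) (λ _ → refl) b<r)
          (trans (∑-cong s λ i i<s → copySum labels labelAt-copy c∈ b<r i<s) (∑-const s (copyValue n γ)))

  labeling-antimagic : IsLocalAntimagic (Hgraph mg r s) labeling
  labeling-antimagic e with ∈-edges-H⁻ mg templated {r} {s} (∈-lookup e)
  ... | b , i , (c , c′) , b<r , i<s , e∈ , edge≡ =
    subst (λ p → vsum (Hgraph mg r s) labeling (proj₁ p) ≢ vsum (Hgraph mg r s) labeling (proj₂ p)) (sym edge≡)
      λ values≡ → All.lookup proper e∈ (colourValue-injective 0<s 0<n (begin
        colourValue s n (colour c)                                ≡⟨ vertexValue c∈ b<r i<s ⟨
        vsum (Hgraph mg r s) labeling (embed (suc b) (suc i) c)  ≡⟨ values≡ ⟩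
        vsum (Hgraph mg r s) labeling (embed (suc b) (suc i) c′) ≡⟨ vertexValue c′∈ b<r i<s ⟩
        colourValue s n (colour c′)                               ∎))
    where
    open ≡-Reasoning
    c∈ = proj₁ (All.lookup endpoints e∈)
    c′∈ = proj₂ (All.lookup endpoints e∈)

  vertexColour : ∀ {x} → x ∈ vertexList (Hgraph mg r s) → ∃[ col ] vsum (Hgraph mg r s) labeling x ≡ colourValue s n col
  vertexColour x∈ with vertexList⁻ (Hgraph mg r s) x∈
  ... | p , p∈ , x≡ with ∈-edges-H⁻ mg templated {r} {s} p∈
  ... | b , i , (c , c′) , b<r , i<s , e∈ , refl with x≡
  ... | inj₁ refl = colour c , vertexValue (proj₁ (All.lookup endpoints e∈)) b<r i<s
  ... | inj₂ refl = colour c′ , vertexValue (proj₂ (All.lookup endpoints e∈)) b<r i<s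

  labeling-numColours≤3 : numColours (Hgraph mg r s) labeling ≤ 3
  labeling-numColours≤3 = numColours≤3 (Hgraph mg r s) labeling (oneOfThree ∘ vertexColour)
    where
    oneOfThree : ∀ {v} → ∃[ col ] v ≡ colourValue s n col →
      v ≡ colourValue s n α ⊎ v ≡ colourValue s n β ⊎ v ≡ colourValue s n γ
    oneOfThree (α , v≡) = inj₁ v≡
    oneOfThree (β , v≡) = inj₂ (inj₁ v≡)
    oneOfThree (γ , v≡) = inj₂ (inj₂ v≡)

-- Lower bounds

module _ (mg : MergeMap) (templated : Templated mg) {r s : ℕ} (0<r : 0 < r) where

  -- Template edge j is u_t u_{t+1} for j = 2t − 2, v_t v_{t+1} for j = 2t − 1, and u_{2t} v_{2t} for j = 15 + t.
  templateEdgeAt : ∀ {i} → i < s → (j : Fin 20) →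
    Adjacent (Hgraph mg r s) (embed 1 (suc i) (proj₁ (lookup (template mg) j))) (embed 1 (suc i) (proj₂ (lookup (template mg) j)))
  templateEdgeAt i<s j = inj₁ (∈-edges-H⁺ mg templated {r} {s} 0<r i<s (∈-lookup j))

lowerBound₂ : ∀ {r s} → 0 < r → 0 < s →
  ∀ f → IsLocalAntimagic (Hgraph merge₂ r s) f → 3 ≤ numColours (Hgraph merge₂ r s) f
lowerBound₂ {r} {s} 0<r 0<s f antimagic =
  triangle⇒3≤numColours (Hgraph merge₂ r s) f antimagic
    (Adjacent-sym (Hgraph merge₂ r s) (copyEdge (# 14))) (copyEdge (# 13)) (copyEdge (# 19))
  where copyEdge = templateEdgeAt merge₂ templated₂ 0<r 0<s

lowerBound₃ : ∀ {r s} → 0 < r → 0 < s →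
  ∀ f → IsLocalAntimagic (Hgraph merge₃ r s) f → 3 ≤ numColours (Hgraph merge₃ r s) f
lowerBound₃ {r} {s} 0<r 0<s f antimagic =
  triangle⇒3≤numColours (Hgraph merge₃ r s) f antimagic (copyEdge (# 0)) (copyEdge (# 1)) (copyEdge (# 16))
  where copyEdge = templateEdgeAt merge₃ templated₃ 0<r 0<s

xSide ySide : List Slot
xSide = mergedX 1 ∷ mergedX 2 ∷ plain v 2 ∷ plain v 4 ∷ plain v 6 ∷ plain v 8 ∷ []
ySide = mergedY 1 ∷ mergedY 2 ∷ plain u 2 ∷ plain u 4 ∷ plain u 6 ∷ plain u 8 ∷ []

xSide-meets-once : All (λ e → SlotIncidence.meetCount xSide e ≡ 1) (template merge₁)
xSide-meets-once = toWitness {a? = All.all? (λ e → SlotIncidence.meetCount xSide e ℕ.≟ 1) (template merge₁)} _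

ySide-meets-once : All (λ e → SlotIncidence.meetCount ySide e ≡ 1) (template merge₁)
ySide-meets-once = toWitness {a? = All.all? (λ e → SlotIncidence.meetCount ySide e ℕ.≟ 1) (template merge₁)} _

module LowerBound₁ {r s : ℕ} (0<r : 0 < r) (0<s : 0 < s) (f : Labeling (Hgraph merge₁ r s))
                   (antimagic : IsLocalAntimagic (Hgraph merge₁ r s) f) where
  open CopyDecomposition merge₁ templated₁ r s f

  private
    H₁ : Graph
    H₁ = Hgraph merge₁ r s
    value : MV → ℕ
    value = vsum H₁ f
    copyEdge = templateEdgeAt merge₁ templated₁ {s = s} 0<r
    w : ℕ → ℕ → ℕ
    w = copyWeights merge₁ r s labels 0

  blockTotal : Slot → ℕ
  blockTotal c = ∑[ i < s ] slotSum c (template merge₁) (w i)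

  blockTotal-merged : ∀ c → (∀ i → embed 1 (suc i) c ≡ embed 1 1 c) → blockTotal c ≡ value (embed 1 1 c)
  blockTotal-merged c copy-independent = sym (vsum-merged c copy-independent 0<r)

  blockTotal-plain : ∀ σ t → blockTotal (plain σ t) ≡ ∑[ i < s ] value (orig 1 (suc i) σ t)
  blockTotal-plain σ t = ∑-cong s λ i i<s → sym (vsum-plain σ t 0<r i<s)

  sides-balance : sum (map blockTotal xSide) ≡ sum (map blockTotal ySide)
  sides-balance = begin
    sum (map blockTotal xSide)
      ≡⟨ ∑-sum-map s (λ i c → slotSum c (template merge₁) (w i)) xSide ⟨
    ∑[ i < s ] sum (map (λ c → slotSum c (template merge₁) (w i)) xSide)
      ≡⟨ ∑-cong s (λ i _ →
           trans (SlotIncidence.incidenceSum-bipartite xSide (template merge₁) (w i) xSide-meets-once)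
                 (sym (SlotIncidence.incidenceSum-bipartite ySide (template merge₁) (w i) ySide-meets-once))) ⟩
    ∑[ i < s ] sum (map (λ c → slotSum c (template merge₁) (w i)) ySide)
      ≡⟨ ∑-sum-map s (λ i c → slotSum c (template merge₁) (w i)) ySide ⟩
    sum (map blockTotal ySide) ∎
    where open ≡-Reasoning

  lowerBound : 3 ≤ numColours H₁ f
  lowerBound with 3 ≤? numColours H₁ f
  ... | yes 3≤ = 3≤
  ... | no fewer = contradiction (*-cancelˡ-≡ (value a) (value b) (2 + 4 * s) (trans (sym xSide-total) (trans sides-balance ySide-total)))
                                 (Adjacent⇒vsum≢ H₁ f antimagic ab)
    where
    a = X 1 1
    b = orig 1 1 u 2
    ab : Adjacent H₁ a b
    ab = copyEdge 0<s (# 0)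
    open TwoColours H₁ f antimagic fewer ab using (neighbour)
    open TwoColours H₁ f antimagic fewer (Adjacent-sym H₁ ab) using () renaming (neighbour to neighbour′)

    u₂ : ∀ {i} → i < s → value (orig 1 (suc i) u 2) ≡ value b
    u₂ i<s = neighbour (copyEdge i<s (# 0)) refl
    X₂ : value (X 1 2) ≡ value a
    X₂ = neighbour′ (copyEdge 0<s (# 2)) (u₂ 0<s)
    u₄ u₆ u₈ : ∀ {i} → i < s → value (orig 1 (suc i) u _) ≡ value b
    u₄ i<s = neighbour (copyEdge i<s (# 4)) X₂
    u₆ i<s = neighbour (copyEdge i<s (# 8)) refl
    u₈ i<s = neighbour (Adjacent-sym H₁ (copyEdge i<s (# 14))) refl
    v₂ v₄ v₆ v₈ : ∀ {i} → i < s → value (orig 1 (suc i) v _) ≡ value a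
    v₂ i<s = neighbour′ (copyEdge i<s (# 16)) (u₂ i<s)
    v₄ i<s = neighbour′ (copyEdge i<s (# 17)) (u₄ i<s)
    v₆ i<s = neighbour′ (copyEdge i<s (# 18)) (u₆ i<s)
    v₈ i<s = neighbour′ (copyEdge i<s (# 19)) (u₈ i<s)
    Y₁ : value (Y 1 1) ≡ value b
    Y₁ = neighbour (Adjacent-sym H₁ (copyEdge 0<s (# 1))) (v₂ 0<s)
    Y₂ : value (Y 1 2) ≡ value b
    Y₂ = neighbour (copyEdge 0<s (# 3)) (v₂ 0<s)

    plainTotal : ∀ {σ t c} → (∀ {i} → i < s → value (orig 1 (suc i) σ t) ≡ c) → blockTotal (plain σ t) ≡ s * c
    plainTotal {σ} {t} {c} ≡c = trans (blockTotal-plain σ t) (trans (∑-cong s λ _ → ≡c) (∑-const s c))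

    sideTotal : ∀ s c → c + (c + (s * c + (s * c + (s * c + (s * c + 0))))) ≡ (2 + 4 * s) * c
    sideTotal = solve-∀

    xSide-total : sum (map blockTotal xSide) ≡ (2 + 4 * s) * value a
    xSide-total =
      trans (cong₂ _+_ (blockTotal-merged (mergedX 1) λ _ → refl)
            (cong₂ _+_ (trans (blockTotal-merged (mergedX 2) λ _ → refl) X₂)
            (cong₂ _+_ (plainTotal v₂) (cong₂ _+_ (plainTotal v₄) (cong₂ _+_ (plainTotal v₆) (cong (_+ 0) (plainTotal v₈)))))))
            (sideTotal s (value a))

    ySide-total : sum (map blockTotal ySide) ≡ (2 + 4 * s) * value b
    ySide-total =
      trans (cong₂ _+_ (trans (blockTotal-merged (mergedY 1) λ _ → refl) Y₁)
            (cong₂ _+_ (trans (blockTotal-merged (mergedY 2) λ _ → refl) Y₂)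
            (cong₂ _+_ (plainTotal u₂) (cong₂ _+_ (plainTotal u₄) (cong₂ _+_ (plainTotal u₆) (cong (_+ 0) (plainTotal u₈)))))))
            (sideTotal s (value b))

χla≡3 : ∀ mg → Balanced mg → ∀ {r s} → 0 < r → 0 < s →
  (∀ f → IsLocalAntimagic (Hgraph mg r s) f → 3 ≤ numColours (Hgraph mg r s) f) → ChiLa≡ (Hgraph mg r s) 3
χla≡3 mg balanced {r} {s} 0<r 0<s = ChiLa≡-intro _ labeling labeling-antimagic labeling-numColours≤3
  where open Construction mg balanced r s 0<r 0<s

theorem3p7 : (r s m : ℕ) → 1 ≤ r → 2 ≤ s → (m ≡ 1 ⊎ m ≡ 2 ⊎ m ≡ 3) →
    ChiLa≡ (H m r s) 3
theorem3p7 r s .1 0<r 1<s (inj₁ refl)        = χla≡3 merge₁ balanced₁ 0<r (<⇒≤ 1<s) (LowerBound₁.lowerBound 0<r (<⇒≤ 1<s))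
theorem3p7 r s .2 0<r 1<s (inj₂ (inj₁ refl)) = χla≡3 merge₂ balanced₂ 0<r (<⇒≤ 1<s) (lowerBound₂ 0<r (<⇒≤ 1<s))
theorem3p7 r s .3 0<r 1<s (inj₂ (inj₂ refl)) = χla≡3 merge₃ balanced₃ 0<r (<⇒≤ 1<s) (lowerBound₃ 0<r (<⇒≤ 1<s))
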